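{- For all integers $n \geq 2$, $k \geq 1$ and $i \in \{0,\dots,k\}$, the map $\phi_i^{(n,k)}$ is a bijection from $\mathcal{Z}_i(n,k)$ onto the disjoint union $$\bigl(\{0,\dots,k\} \times \mathcal{Z}_i(n-1,k)\bigr) \;\sqcup\; \Bigl(\{0,\dots,i\} \times \bigsqcup_{j=i+1}^{k} \mathcal{Z}_j(n-1,k)\Bigr).$$
   Context: For $n\ge1$, $\mathsf{Tr}(n)$ is the set of words $u = u_1\cdots u_n$ over $\{0,1,2\}$ with $u_1 \neq 2$ and no indices $i<j$ with $u_i=0$, $u_j=1$, ordered componentwise ($u\preccurlyeq v$ iff $u_i\le v_i$ for all $i$). A $k$-chain of $\mathsf{Tr}(n)$ is a sequence $(u^{(1)},\dots,u^{(k)})$ with $u^{(1)}\preccurlyeq\cdots\preccurlyeq u^{(k)}$ (repetitions allowed). For $i \in \{0,\dots,k\}$, $\mathcal{Z}_i(n,k)$ is the set of $k$-chains such that $u^{(r)}$ contains the letter $0$ for every $r \in \{1,\dots,k-i\}$ and $u^{(s)}$ does not contain the letter $0$ for every $s \in \{k-i+1,\dots,k\}$. For $\gamma \in \mathcal{Z}_i(n,k)$, $\phi_i^{(n,k)}(\gamma) := (\mathfrak{t}, \gamma')$, where $\gamma'$ is the $k$-chain of $\mathsf{Tr}(n-1)$ obtained by deleting the last letter of each word of $\gamma$, and $\mathfrak{t}$ is the number of words of $\gamma$ whose last letter is $2$. -}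

module Defs where

open import Data.Nat using (ℕ; zero; suc; _∸_; _≤_; _<_)
open import Data.Fin as Fin using (Fin; toℕ)
open import Data.Fin.Properties using (_≟_)
open import Data.Vec using (Vec; lookup; init; last; map; count)
open import Data.Vec.Membership.Propositional using (_∈_; _∉_)
open import Data.Product using (_×_; _,_; Σ-syntax)
open import Data.Sum using (_⊎_)
open import Relation.Binary.PropositionalEquality using (_≡_; _≢_)

Word : ℕ → Set
Word n = Vec (Fin 3) n

IsTr : {n : ℕ} → Word n → Set
IsTr {n} u =
  (∀ (p : Fin n) → toℕ p ≡ 0 → lookup u p ≢ Fin.suc (Fin.suc Fin.zero))
  × (∀ (p q : Fin n) → toℕ p < toℕ q → lookup u p ≡ Fin.zero → lookup u q ≢ Fin.suc Fin.zero)

_≼_ : {n : ℕ} → Word n → Word n → Set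
_≼_ {n} u v = ∀ (p : Fin n) → toℕ (lookup u p) ≤ toℕ (lookup v p)

IsChain : (n k : ℕ) → Vec (Word n) k → Set
IsChain n k γ =
  (∀ (r : Fin k) → IsTr (lookup γ r))
  × (∀ (r s : Fin k) → toℕ r ≤ toℕ s → lookup γ r ≼ lookup γ s)

-- Z_i(n,k): chains whose words u⁽¹⁾..u⁽ᵏ⁻ⁱ⁾ contain 0 and u⁽ᵏ⁻ⁱ⁺¹⁾..u⁽ᵏ⁾ do not
-- (0-based index r corresponds to the word u⁽ʳ⁺¹⁾).
Z : (i n k : ℕ) → Vec (Word n) k → Set
Z i n k γ =
  IsChain n k γ
  × (∀ (r : Fin k) → toℕ r < k ∸ i → Fin.zero ∈ lookup γ r)
  × (∀ (r : Fin k) → k ∸ i ≤ toℕ r → Fin.zero ∉ lookup γ r)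

φ : {n k : ℕ} → Vec (Word (suc n)) k → ℕ × Vec (Word n) k
φ γ = count (λ w → last w ≟ Fin.suc (Fin.suc Fin.zero)) γ , map init γ

Target : (n k i : ℕ) → ℕ × Vec (Word n) k → Set
Target n k i (t , γ) =
  (t ≤ k × Z i n k γ)
  ⊎ (t ≤ i × Σ[ j ∈ ℕ ] (i < j × j ≤ k × Z j n k γ))

module Submission where

-- The key notion is a final segment: a property of the positions 0..k-1 that
-- holds exactly at the last t of them.  In a chain, "ends in 2" and "contains no
-- 0" are upward closed, hence final segments whose lengths are the counts of
-- such words; in particular every chain of Tr(n) lies in Z_m(n,k) for m its
-- number of zero-free words.  Using the characterisation of Tr(n+1)-words as
-- Tr(n)-words followed by a letter that is not a 1 after a 0, one shows that the
-- last letters of γ ∈ Z_i(n+1,k) form the column "0 … 0 1 … 1 2 … 2" determined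
-- by i and t (last-column).  This gives injectivity; surjectivity appends that
-- column to a given chain; and comparing the zero-free segments of γ and of its
-- prefixes places φ γ in the target.

open import Defs
open import Data.Nat using (ℕ; zero; suc; _∸_; _≤_; _<_; z≤n; s≤s; s≤s⁻¹; _≤?_; _<?_)
open import Data.Nat.Properties
  using (≤-refl; ≤-trans; ≤-antisym; ≤-<-trans; <-≤-trans; <-irrefl; <-asym; <⇒≤; <⇒≱; ≮⇒≥;
         n≤0⇒n≡0; 1+n≰n; ∸-cancelʳ-≤; ∸-monoʳ-≤; +-∸-assoc; n∸n≡0; m≤n⇒m<n∨m≡n)
open import Data.Fin as Fin using (Fin; toℕ; inject₁; fromℕ; fromℕ<; opposite)
open import Data.Fin.Properties
  using (toℕ-inject₁; toℕ-fromℕ; toℕ-fromℕ<; toℕ<n; toℕ-injective; opposite-prop; _≟_)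
open import Data.Vec using (Vec; []; _∷_; lookup; init; last; map; count; _∷ʳ_; initLast; tabulate)
open import Data.Vec.Properties
  using (count≤n; lookup-map; lookup∘tabulate; tabulate-∘; tabulate-cong; tabulate∘lookup; init-∷ʳ; last-∷ʳ)
open import Data.Vec.Membership.Propositional using (_∈_; _∉_)
open import Data.Vec.Membership.Propositional.Properties using (∈-lookup)
open import Data.Vec.Membership.DecPropositional (_≟_ {3}) using (_∈?_)
open import Data.Vec.Relation.Unary.Any using (here; there; index)
open import Data.Vec.Relation.Unary.Any.Properties using (lookup-index)
open import Data.Vec.Relation.Binary.Pointwise.Extensional using (ext; Pointwise-≡⇒≡)
open import Data.Product using (_×_; _,_; proj₁; proj₂; Σ-syntax)
open import Data.Sum using (_⊎_; inj₁; inj₂; [_,_]′)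
open import Function using (_∘_)
open import Function.Bundles using (_⇔_; mk⇔; Equivalence)
open import Relation.Nullary using (¬_; yes; no; ¬?; contradiction)
open import Relation.Nullary.Decidable using (decidable-stable)
open import Relation.Unary using (Decidable)
open import Relation.Binary.PropositionalEquality

open Equivalence using (to; from)

FinalSegment : {k : ℕ} → (Fin k → Set) → ℕ → Set
FinalSegment {k} S t = ∀ r → S r ⇔ k ∸ t ≤ toℕ r

UpClosed : {k : ℕ} → (Fin k → Set) → Set
UpClosed {k} S = ∀ (r s : Fin k) → toℕ r ≤ toℕ s → S r → S s

-- The j-th position counted from the end (j = 0 is the last position).
fromEnd : {j k : ℕ} → j < k → Fin k
fromEnd j<k = opposite (fromℕ< j<k)

toℕ-fromEnd : ∀ {j k} (j<k : j < k) → toℕ (fromEnd j<k) ≡ k ∸ suc j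
toℕ-fromEnd {k = k} j<k = trans (opposite-prop (fromℕ< j<k)) (cong (λ x → k ∸ suc x) (toℕ-fromℕ< j<k))

final-at : ∀ {k t} {S : Fin k → Set} → FinalSegment S t →
           ∀ {j} (j<k : j < k) → S (fromEnd j<k) ⇔ j < t
final-at {k} {t} f {j} j<k = mk⇔
  (λ s → ∸-cancelʳ-≤ j<k (subst (k ∸ t ≤_) (toℕ-fromEnd j<k) (to (f _) s)))
  (λ j<t → from (f _) (subst (k ∸ t ≤_) (sym (toℕ-fromEnd j<k)) (∸-monoʳ-≤ k j<t)))

final-≤ : ∀ {k t s} {S S′ : Fin k → Set} → FinalSegment S t → FinalSegment S′ s →
          t ≤ k → (∀ r → S r → S′ r) → t ≤ s
final-≤ {t = t} {s} f f′ t≤k S⇒S′ with s <? t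
... | no s≮t = ≮⇒≥ s≮t
... | yes s<t = contradiction (to (final-at f′ s<k) (S⇒S′ _ (from (final-at f s<k) s<t))) (<-irrefl refl)
  where s<k = <-≤-trans s<t t≤k

final⇒upClosed : ∀ {k t} {S : Fin k → Set} → FinalSegment S t → UpClosed S
final⇒upClosed f r s r≤s Sr = from (f s) (≤-trans (to (f r) Sr) r≤s)

module Counting {A : Set} {P : A → Set} (P? : Decidable P) where

  count-all : ∀ {k} (v : Vec A k) → (∀ r → P (lookup v r)) → count P? v ≡ k
  count-all [] _ = refl
  count-all (x ∷ v) all with P? x
  ... | yes _ = cong suc (count-all v (all ∘ Fin.suc))
  ... | no ¬px = contradiction (all Fin.zero) ¬px

  -- Induction on v: if the head satisfies P then so does every entry; otherwise the
  -- final segment of the tail, shifted by one position, is the final segment of v.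
  count-final : ∀ {k} (v : Vec A k) → UpClosed (P ∘ lookup v) → FinalSegment (P ∘ lookup v) (count P? v)
  count-final [] _ ()
  count-final {suc k} (x ∷ v) up with P? x
  ... | yes px rewrite count-all v (λ r → up Fin.zero (Fin.suc r) z≤n px) | n∸n≡0 k =
    λ r → mk⇔ (λ _ → z≤n) (λ _ → up Fin.zero r z≤n px)
  ... | no ¬px rewrite +-∸-assoc 1 (count≤n P? v) = shifted
    where
    ih = count-final v (λ r s r≤s → up (Fin.suc r) (Fin.suc s) (s≤s r≤s))
    shifted : ∀ r → P (lookup (x ∷ v) r) ⇔ suc (k ∸ count P? v) ≤ toℕ r
    shifted Fin.zero = mk⇔ (λ px → contradiction px ¬px) (λ ())
    shifted (Fin.suc r) = mk⇔ (s≤s ∘ to (ih r)) (from (ih r) ∘ s≤s⁻¹)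

  -- Conversely, a final segment of P along v has length count P? v (final segments
  -- are unique, as each is included in the other).
  final-count : ∀ {k t} (v : Vec A k) → t ≤ k → FinalSegment (P ∘ lookup v) t → count P? v ≡ t
  final-count {t = t} v t≤k f =
    ≤-antisym (final-≤ f′ f (count≤n P? v) (λ _ p → p)) (final-≤ f f′ t≤k (λ _ p → p))
    where f′ = count-final v (final⇒upClosed {t = t} f)

open Counting using (count-final; final-count)

module _ {A : Set} where

  init-∷ʳ-last : ∀ {n} (w : Vec A (suc n)) → w ≡ init w ∷ʳ last w
  init-∷ʳ-last w = proj₂ (proj₂ (initLast w))

  lookup-∷ʳ-inject₁ : ∀ {n} (ys : Vec A n) y q → lookup (ys ∷ʳ y) (inject₁ q) ≡ lookup ys q
  lookup-∷ʳ-inject₁ (x ∷ ys) y Fin.zero = refl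
  lookup-∷ʳ-inject₁ (x ∷ ys) y (Fin.suc q) = lookup-∷ʳ-inject₁ ys y q

  lookup-∷ʳ-fromℕ : ∀ {n} (ys : Vec A n) y → lookup (ys ∷ʳ y) (fromℕ n) ≡ y
  lookup-∷ʳ-fromℕ [] y = refl
  lookup-∷ʳ-fromℕ (x ∷ ys) y = lookup-∷ʳ-fromℕ ys y

  ∈-∷ʳ⁻ : ∀ {n x} (ys : Vec A n) y → x ∈ ys ∷ʳ y → x ∈ ys ⊎ x ≡ y
  ∈-∷ʳ⁻ [] y (here x≡y) = inj₂ x≡y
  ∈-∷ʳ⁻ (z ∷ ys) y (here x≡z) = inj₁ (here x≡z)
  ∈-∷ʳ⁻ (z ∷ ys) y (there x∈) with ∈-∷ʳ⁻ ys y x∈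
  ... | inj₁ x∈ys = inj₁ (there x∈ys)
  ... | inj₂ x≡y = inj₂ x≡y

  ∈-∷ʳ⁺ˡ : ∀ {n x} (ys : Vec A n) y → x ∈ ys → x ∈ ys ∷ʳ y
  ∈-∷ʳ⁺ˡ (z ∷ ys) y (here x≡z) = here x≡z
  ∈-∷ʳ⁺ˡ (z ∷ ys) y (there x∈) = there (∈-∷ʳ⁺ˡ ys y x∈)

  ∈-∷ʳ⁺ʳ : ∀ {n} (ys : Vec A n) y → y ∈ ys ∷ʳ y
  ∈-∷ʳ⁺ʳ [] y = here refl
  ∈-∷ʳ⁺ʳ (z ∷ ys) y = there (∈-∷ʳ⁺ʳ ys y)

  ∈-init-last⁻ : ∀ {n x} (w : Vec A (suc n)) → x ∈ w → x ∈ init w ⊎ x ≡ last w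
  ∈-init-last⁻ {x = x} w = ∈-∷ʳ⁻ (init w) (last w) ∘ subst (x ∈_) (init-∷ʳ-last w)

  ∈-init : ∀ {n x} (w : Vec A (suc n)) → x ∈ init w → x ∈ w
  ∈-init {x = x} w = subst (x ∈_) (sym (init-∷ʳ-last w)) ∘ ∈-∷ʳ⁺ˡ (init w) (last w)

  last-∈ : ∀ {n} (w : Vec A (suc n)) → last w ∈ w
  last-∈ w = subst (last w ∈_) (sym (init-∷ʳ-last w)) (∈-∷ʳ⁺ʳ (init w) (last w))

data SnocPosition {n : ℕ} : Fin (suc n) → Set where
  old : (q : Fin n) → SnocPosition (inject₁ q)
  new : SnocPosition (fromℕ n)

snocPosition : ∀ {n} (p : Fin (suc n)) → SnocPosition p
snocPosition {zero} Fin.zero = new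
snocPosition {suc n} Fin.zero = old Fin.zero
snocPosition {suc n} (Fin.suc p) with snocPosition p
... | old q = old (Fin.suc q)
... | new = new

inject₁<fromℕ : ∀ {n} (q : Fin n) → toℕ (inject₁ q) < toℕ (fromℕ n)
inject₁<fromℕ {n} q = subst₂ _<_ (sym (toℕ-inject₁ q)) (sym (toℕ-fromℕ n)) (toℕ<n q)

one two : Fin 3
one = Fin.suc Fin.zero
two = Fin.suc (Fin.suc Fin.zero)

zero-least : ∀ {a : Fin 3} → toℕ a ≤ 0 → a ≡ Fin.zero
zero-least a≤0 = toℕ-injective (n≤0⇒n≡0 a≤0)

two-greatest : ∀ {a b : Fin 3} → a ≡ two → toℕ a ≤ toℕ b → b ≡ two
two-greatest {b = Fin.zero} refl ()
two-greatest {b = Fin.suc Fin.zero} refl (s≤s ())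
two-greatest {b = Fin.suc (Fin.suc Fin.zero)} refl _ = refl

letter-zero : ∀ {a : Fin 3} → a ≢ one → a ≢ two → a ≡ Fin.zero
letter-zero {Fin.zero} _ _ = refl
letter-zero {Fin.suc Fin.zero} a≢1 _ = contradiction refl a≢1
letter-zero {Fin.suc (Fin.suc Fin.zero)} _ a≢2 = contradiction refl a≢2

letter-one : ∀ {a : Fin 3} → a ≢ Fin.zero → a ≢ two → a ≡ one
letter-one {Fin.zero} a≢0 _ = contradiction refl a≢0
letter-one {Fin.suc Fin.zero} _ _ = refl
letter-one {Fin.suc (Fin.suc Fin.zero)} _ a≢2 = contradiction refl a≢2

-- ys ∷ʳ y ∈ Tr(n+1) iff ys ∈ Tr(n) and y is not a 1 following a 0
-- (the converse needs n ≥ 1 so that y is not the first letter).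
tr-∷ʳ⁻ : ∀ {n} {ys : Word n} {y} → IsTr (ys ∷ʳ y) → IsTr ys × (Fin.zero ∈ ys → y ≢ one)
tr-∷ʳ⁻ {n} {ys} {y} (first , order) = (first′ , order′) , no-one-after-zero
  where
  first′ : ∀ p → toℕ p ≡ 0 → lookup ys p ≢ two
  first′ p p≡0 = first (inject₁ p) (trans (toℕ-inject₁ p) p≡0) ∘ trans (lookup-∷ʳ-inject₁ ys y p)
  order′ : ∀ p q → toℕ p < toℕ q → lookup ys p ≡ Fin.zero → lookup ys q ≢ one
  order′ p q p<q ys₀ ys₁ = order (inject₁ p) (inject₁ q)
    (subst₂ _<_ (sym (toℕ-inject₁ p)) (sym (toℕ-inject₁ q)) p<q)
    (trans (lookup-∷ʳ-inject₁ ys y p) ys₀) (trans (lookup-∷ʳ-inject₁ ys y q) ys₁)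
  no-one-after-zero : Fin.zero ∈ ys → y ≢ one
  no-one-after-zero 0∈ys y≡1 = order (inject₁ p) (fromℕ n) (inject₁<fromℕ p)
    (trans (lookup-∷ʳ-inject₁ ys y p) (sym (lookup-index 0∈ys))) (trans (lookup-∷ʳ-fromℕ ys y) y≡1)
    where p = index 0∈ys

tr-∷ʳ⁺ : ∀ {n} {ys : Word n} {y} → 1 ≤ n → IsTr ys → (Fin.zero ∈ ys → y ≢ one) → IsTr (ys ∷ʳ y)
tr-∷ʳ⁺ {n} {ys} {y} 1≤n (first , order) no-one-after-zero = first′ , order′
  where
  first′ : ∀ p → toℕ p ≡ 0 → lookup (ys ∷ʳ y) p ≢ two
  first′ p with snocPosition p
  ... | old q = λ p≡0 e → first q (trans (sym (toℕ-inject₁ q)) p≡0) (trans (sym (lookup-∷ʳ-inject₁ ys y q)) e)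
  ... | new = λ n≡0 _ → 1+n≰n (subst (1 ≤_) (trans (sym (toℕ-fromℕ n)) n≡0) 1≤n)
  order′ : ∀ p q → toℕ p < toℕ q → lookup (ys ∷ʳ y) p ≡ Fin.zero → lookup (ys ∷ʳ y) q ≢ one
  order′ p q with snocPosition p | snocPosition q
  ... | old p′ | old q′ = λ p<q e₀ e₁ → order p′ q′
    (subst₂ _<_ (toℕ-inject₁ p′) (toℕ-inject₁ q′) p<q)
    (trans (sym (lookup-∷ʳ-inject₁ ys y p′)) e₀) (trans (sym (lookup-∷ʳ-inject₁ ys y q′)) e₁)
  ... | old p′ | new = λ _ e₀ e₁ → no-one-after-zero
    (subst (_∈ ys) (trans (sym (lookup-∷ʳ-inject₁ ys y p′)) e₀) (∈-lookup p′ ys))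
    (trans (sym (lookup-∷ʳ-fromℕ ys y)) e₁)
  ... | new | old q′ = λ n<q′ → contradiction (inject₁<fromℕ q′) (<-asym n<q′)
  ... | new | new = λ n<n → contradiction n<n (<-irrefl refl)

≼-∷ʳ⁻ : ∀ {n} {ys zs : Word n} {y z} → (ys ∷ʳ y) ≼ (zs ∷ʳ z) → ys ≼ zs × toℕ y ≤ toℕ z
≼-∷ʳ⁻ {n} {ys} {zs} {y} {z} h =
  (λ q → subst₂ _≤_ (cong toℕ (lookup-∷ʳ-inject₁ ys y q))
                    (cong toℕ (lookup-∷ʳ-inject₁ zs z q)) (h (inject₁ q))) ,
  subst₂ _≤_ (cong toℕ (lookup-∷ʳ-fromℕ ys y)) (cong toℕ (lookup-∷ʳ-fromℕ zs z)) (h (fromℕ n))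

≼-∷ʳ⁺ : ∀ {n} {ys zs : Word n} {y z} → ys ≼ zs → toℕ y ≤ toℕ z → (ys ∷ʳ y) ≼ (zs ∷ʳ z)
≼-∷ʳ⁺ {n} {ys} {zs} {y} {z} ys≼zs y≤z p with snocPosition p
... | old q = subst₂ _≤_ (cong toℕ (sym (lookup-∷ʳ-inject₁ ys y q)))
                       (cong toℕ (sym (lookup-∷ʳ-inject₁ zs z q))) (ys≼zs q)
... | new = subst₂ _≤_ (cong toℕ (sym (lookup-∷ʳ-fromℕ ys y)))
                     (cong toℕ (sym (lookup-∷ʳ-fromℕ zs z))) y≤z

tr-init-last : ∀ {n} {w : Word (suc n)} → IsTr w → IsTr (init w) × (Fin.zero ∈ init w → last w ≢ one)
tr-init-last {w = w} = tr-∷ʳ⁻ {ys = init w} {last w} ∘ subst IsTr (init-∷ʳ-last w)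

≼-init-last : ∀ {n} {u v : Word (suc n)} → u ≼ v → init u ≼ init v × toℕ (last u) ≤ toℕ (last v)
≼-init-last {u = u} {v} =
  ≼-∷ʳ⁻ {ys = init u} {init v} {last u} {last v} ∘ subst₂ _≼_ (init-∷ʳ-last u) (init-∷ʳ-last v)

chain-init : ∀ {n k} (γ : Vec (Word (suc n)) k) → IsChain (suc n) k γ → IsChain n k (map init γ)
chain-init γ (tr , ord) =
  (λ r → subst IsTr (sym (lookup-map r init γ)) (proj₁ (tr-init-last (tr r)))) ,
  (λ r s r≤s → subst₂ _≼_ (sym (lookup-map r init γ)) (sym (lookup-map s init γ))
                          (proj₁ (≼-init-last (ord r s r≤s))))

ZeroFree : ∀ {n} → Word n → Set
ZeroFree w = Fin.zero ∉ w

zeroFree? : ∀ {n} → Decidable (ZeroFree {n})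
zeroFree? w = ¬? (Fin.zero ∈? w)

zero-∈-≼ : ∀ {n} {u v : Word n} → u ≼ v → Fin.zero ∈ v → Fin.zero ∈ u
zero-∈-≼ {u = u} u≼v 0∈v = subst (_∈ u) (zero-least u₀≤0) (∈-lookup p u)
  where
  p = index 0∈v
  u₀≤0 : toℕ (lookup u p) ≤ 0
  u₀≤0 = subst (λ b → toℕ (lookup u p) ≤ toℕ b) (sym (lookup-index 0∈v)) (u≼v p)

zeroFree-upClosed : ∀ {n k} (γ : Vec (Word n) k) → IsChain n k γ → UpClosed (ZeroFree ∘ lookup γ)
zeroFree-upClosed γ (_ , ord) r s r≤s zf = zf ∘ zero-∈-≼ (ord r s r≤s)

Z⇒final : ∀ {n k} i (γ : Vec (Word n) k) → Z i n k γ → FinalSegment (ZeroFree ∘ lookup γ) i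
Z⇒final i γ (_ , has , lacks) r = mk⇔ (λ zf → ≮⇒≥ (zf ∘ has r)) (lacks r)

chain⇒Z : ∀ {n k} (γ : Vec (Word n) k) → IsChain n k γ → Z (count zeroFree? γ) n k γ
chain⇒Z {k = k} γ ch = ch , has , (λ r → from (zf r))
  where
  zf = count-final zeroFree? γ (zeroFree-upClosed γ ch)
  has : ∀ r → toℕ r < k ∸ count zeroFree? γ → Fin.zero ∈ lookup γ r
  has r r<m with Fin.zero ∈? lookup γ r
  ... | yes 0∈ = 0∈
  ... | no 0∉ = contradiction (to (zf r) 0∉) (<⇒≱ r<m)

EndsInTwo : ∀ {n} → Word (suc n) → Set
EndsInTwo w = last w ≡ two

endsInTwo? : ∀ {n} → Decidable (EndsInTwo {n})
endsInTwo? w = last w ≟ two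

twos-final : ∀ {n k} (γ : Vec (Word (suc n)) k) → IsChain (suc n) k γ →
             FinalSegment (EndsInTwo ∘ lookup γ) (count endsInTwo? γ)
twos-final γ (_ , ord) =
  count-final endsInTwo? γ (λ r s r≤s e → two-greatest e (proj₂ (≼-init-last (ord r s r≤s))))

last-zero : ∀ {n} {w : Word (suc n)} → IsTr w → Fin.zero ∈ w → ¬ EndsInTwo w → last w ≡ Fin.zero
last-zero {w = w} tw 0∈w ¬two with ∈-init-last⁻ w 0∈w
... | inj₁ 0∈init = letter-zero (proj₂ (tr-init-last tw) 0∈init) ¬two
... | inj₂ 0≡last = sym 0≡last

last-one : ∀ {n} {w : Word (suc n)} → ZeroFree w → ¬ EndsInTwo w → last w ≡ one
last-one {w = w} zf ¬two = letter-one (λ last≡0 → zf (subst (_∈ w) last≡0 (last-∈ w))) ¬two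

-- The last letters of γ ∈ Z_i(n+1,k) with t words ending in 2, read along the
-- positions r: 0 on the first k∸i words, 2 on the last t words, 1 in between.
column : (k i t r : ℕ) → Fin 3
column k i t r with k ∸ t ≤? r | r <? k ∸ i
... | yes _ | _ = two
... | no _ | yes _ = Fin.zero
... | no _ | no _ = one

column-two : ∀ k i t r → column k i t r ≡ two ⇔ k ∸ t ≤ r
column-two k i t r with k ∸ t ≤? r | r <? k ∸ i
... | yes r∈ | _ = mk⇔ (λ _ → r∈) (λ _ → refl)
... | no r∉ | yes _ = mk⇔ (λ ()) (λ r∈ → contradiction r∈ r∉)
... | no r∉ | no _ = mk⇔ (λ ()) (λ r∈ → contradiction r∈ r∉)

column-zero⁻ : ∀ k i t r → column k i t r ≡ Fin.zero → r < k ∸ i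
column-zero⁻ k i t r with k ∸ t ≤? r | r <? k ∸ i
... | yes _ | _ = λ ()
... | no _ | yes r< = λ _ → r<
... | no _ | no _ = λ ()

column-one⁻ : ∀ k i t r → column k i t r ≡ one → k ∸ i ≤ r
column-one⁻ k i t r with k ∸ t ≤? r | r <? k ∸ i
... | yes _ | _ = λ ()
... | no _ | yes _ = λ ()
... | no _ | no r≮ = λ _ → ≮⇒≥ r≮

column-zero : ∀ {k i t r} → t ≤ i → r < k ∸ i → column k i t r ≡ Fin.zero
column-zero {k} {i} {t} {r} t≤i r< with k ∸ t ≤? r | r <? k ∸ i
... | yes r∈ | _ = contradiction (≤-trans (∸-monoʳ-≤ k t≤i) r∈) (<⇒≱ r<)
... | no _ | yes _ = refl
... | no _ | no r≮ = contradiction r< r≮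

column-mono : ∀ k i t {r s} → r ≤ s → toℕ (column k i t r) ≤ toℕ (column k i t s)
column-mono k i t {r} {s} r≤s with k ∸ t ≤? r | k ∸ t ≤? s | r <? k ∸ i | s <? k ∸ i
... | yes _ | yes _ | _ | _ = ≤-refl
... | yes r∈ | no s∉ | _ | _ = contradiction (≤-trans r∈ r≤s) s∉
... | no _ | yes _ | yes _ | _ = z≤n
... | no _ | yes _ | no _ | _ = s≤s z≤n
... | no _ | no _ | yes _ | _ = z≤n
... | no _ | no _ | no r≮ | yes s< = contradiction (≤-<-trans r≤s s<) r≮
... | no _ | no _ | no _ | no _ = ≤-refl

last-column : ∀ {i n k} (γ : Vec (Word (suc n)) k) → Z i (suc n) k γ →
              ∀ r → last (lookup γ r) ≡ column k i (count endsInTwo? γ) (toℕ r)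
last-column {i} {n} {k} γ (ch , has , lacks) r with k ∸ count endsInTwo? γ ≤? toℕ r | toℕ r <? k ∸ i
... | yes r∈ | _ = from (twos-final γ ch r) r∈
... | no r∉ | yes r< = last-zero (proj₁ ch r) (has r r<) (r∉ ∘ to (twos-final γ ch r))
... | no r∉ | no r≮ = last-one (lacks r (≮⇒≥ r≮)) (r∉ ∘ to (twos-final γ ch r))

-- If the prefixes of γ ∈ Z_i(n+1,k) have more than i zero-free words, then the
-- (i+1)-th word from the end has its only 0 at the end, so at most i words end in 2.
few-twos : ∀ {i n k} (γ : Vec (Word (suc n)) k) → Z i (suc n) k γ →
           i < count zeroFree? (map init γ) → count endsInTwo? γ ≤ i
few-twos {i} {n} {k} γ Zγ i<m = ≮⇒≥ (λ i<t → zero≢two (trans zero-at-end (from (final-at twos i<k) i<t)))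
  where
  twos = twos-final γ (proj₁ Zγ)
  γ′ = map init γ
  prefixes-final = Z⇒final (count zeroFree? γ′) γ′ (chain⇒Z γ′ (chain-init γ (proj₁ Zγ)))
  i<k : i < k
  i<k = <-≤-trans i<m (count≤n zeroFree? γ′)
  w = lookup γ (fromEnd i<k)
  init-zeroFree : ZeroFree (init w)
  init-zeroFree = subst ZeroFree (lookup-map (fromEnd i<k) init γ) (from (final-at prefixes-final i<k) i<m)
  not-zeroFree : ¬ ZeroFree w
  not-zeroFree zf = <-irrefl refl (to (final-at (Z⇒final i γ Zγ) i<k) zf)
  zero-at-end : Fin.zero ≡ last w
  zero-at-end with ∈-init-last⁻ w (decidable-stable (Fin.zero ∈? w) not-zeroFree)
  ... | inj₁ 0∈init = contradiction 0∈init init-zeroFree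
  ... | inj₂ 0≡last = 0≡last
  zero≢two : Fin.zero ≢ two
  zero≢two ()

-- The prefixes of γ form a chain in Z_m(n,k) with i ≤ m (zero-free words stay
-- zero-free); if m = i we land in the first part of the target, else in the second.
φ-sound : ∀ {i n k} (γ : Vec (Word (suc n)) k) → i ≤ k → Z i (suc n) k γ → Target n k i (φ γ)
φ-sound {i} {n} {k} γ i≤k Zγ = place (m≤n⇒m<n∨m≡n i≤m)
  where
  γ′ = map init γ
  m = count zeroFree? γ′
  Zm : Z m n k γ′
  Zm = chain⇒Z γ′ (chain-init γ (proj₁ Zγ))
  prefix-zeroFree : ∀ r → ZeroFree (lookup γ r) → ZeroFree (lookup γ′ r)
  prefix-zeroFree r zf = zf ∘ ∈-init (lookup γ r) ∘ subst (Fin.zero ∈_) (lookup-map r init γ)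
  i≤m : i ≤ m
  i≤m = final-≤ (Z⇒final i γ Zγ) (Z⇒final m γ′ Zm) i≤k prefix-zeroFree
  place : i < m ⊎ i ≡ m → Target n k i (φ γ)
  place (inj₁ i<m) = inj₂ (few-twos γ Zγ i<m , m , i<m , count≤n zeroFree? γ′ , Zm)
  place (inj₂ i≡m) = inj₁ (count≤n endsInTwo? γ , subst (λ j → Z j n k γ′) (sym i≡m) Zm)

-- Words agree on their prefixes (recorded by φ) and on their last letters
-- (the column determined by i and the count recorded by φ).
φ-injective : ∀ {i n k} (γ δ : Vec (Word (suc n)) k) →
              Z i (suc n) k γ → Z i (suc n) k δ → φ γ ≡ φ δ → γ ≡ δ
φ-injective {i} {n} {k} γ δ Zγ Zδ φγ≡φδ = Pointwise-≡⇒≡ (ext same-word)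
  where
  open ≡-Reasoning
  same-init : ∀ r → init (lookup γ r) ≡ init (lookup δ r)
  same-init r = begin
    init (lookup γ r)      ≡⟨ lookup-map r init γ ⟨
    lookup (map init γ) r  ≡⟨ cong (λ v → lookup v r) (cong proj₂ φγ≡φδ) ⟩
    lookup (map init δ) r  ≡⟨ lookup-map r init δ ⟩
    init (lookup δ r)      ∎
  same-last : ∀ r → last (lookup γ r) ≡ last (lookup δ r)
  same-last r = begin
    last (lookup γ r)                        ≡⟨ last-column γ Zγ r ⟩
    column k i (count endsInTwo? γ) (toℕ r)  ≡⟨ cong (λ t → column k i t (toℕ r)) (cong proj₁ φγ≡φδ) ⟩
    column k i (count endsInTwo? δ) (toℕ r)  ≡⟨ last-column δ Zδ r ⟨
    last (lookup δ r)                        ∎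
  same-word : ∀ r → lookup γ r ≡ lookup δ r
  same-word r = begin
    lookup γ r                              ≡⟨ init-∷ʳ-last (lookup γ r) ⟩
    init (lookup γ r) ∷ʳ last (lookup γ r)  ≡⟨ cong₂ _∷ʳ_ (same-init r) (same-last r) ⟩
    init (lookup δ r) ∷ʳ last (lookup δ r)  ≡⟨ init-∷ʳ-last (lookup δ r) ⟨
    lookup δ r                              ∎

-- Append the letter col r to the r-th word of γ′ (the inverse of φ, given the column).
attach : ∀ {n k} → Vec (Word n) k → (Fin k → Fin 3) → Vec (Word (suc n)) k
attach γ′ col = tabulate (λ r → lookup γ′ r ∷ʳ col r)

lookup-attach : ∀ {n k} (γ′ : Vec (Word n) k) col r → lookup (attach γ′ col) r ≡ lookup γ′ r ∷ʳ col r
lookup-attach γ′ col = lookup∘tabulate (λ r → lookup γ′ r ∷ʳ col r)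

last-attach : ∀ {n k} (γ′ : Vec (Word n) k) col r → last (lookup (attach γ′ col) r) ≡ col r
last-attach γ′ col r = trans (cong last (lookup-attach γ′ col r)) (last-∷ʳ (col r) (lookup γ′ r))

init-attach : ∀ {n k} (γ′ : Vec (Word n) k) col → map init (attach γ′ col) ≡ γ′
init-attach γ′ col = begin
  map init (tabulate (λ r → lookup γ′ r ∷ʳ col r))  ≡⟨ tabulate-∘ init (λ r → lookup γ′ r ∷ʳ col r) ⟨
  tabulate (λ r → init (lookup γ′ r ∷ʳ col r))      ≡⟨ tabulate-cong (λ r → init-∷ʳ (col r) (lookup γ′ r)) ⟩
  tabulate (lookup γ′)                              ≡⟨ tabulate∘lookup γ′ ⟩
  γ′                                                ∎
  where open ≡-Reasoning

attach-chain : ∀ {n k} (γ′ : Vec (Word n) k) (col : Fin k → Fin 3) → 1 ≤ n → IsChain n k γ′ →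
               (∀ r → Fin.zero ∈ lookup γ′ r → col r ≢ one) →
               (∀ r s → toℕ r ≤ toℕ s → toℕ (col r) ≤ toℕ (col s)) →
               IsChain (suc n) k (attach γ′ col)
attach-chain γ′ col 1≤n (tr , ord) no-one-after-zero mono =
  (λ r → subst IsTr (sym (lookup-attach γ′ col r))
                (tr-∷ʳ⁺ {ys = lookup γ′ r} {col r} 1≤n (tr r) (no-one-after-zero r))) ,
  (λ r s r≤s → subst₂ _≼_ (sym (lookup-attach γ′ col r)) (sym (lookup-attach γ′ col s))
                 (≼-∷ʳ⁺ {ys = lookup γ′ r} {lookup γ′ s} {col r} {col s} (ord r s r≤s) (mono r s r≤s)))

attach-Z : ∀ {n k} i t (γ′ : Vec (Word n) k) → 1 ≤ n → IsChain n k γ′ →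
           (∀ r → k ∸ i ≤ toℕ r → ZeroFree (lookup γ′ r)) →
           (∀ r → toℕ r < k ∸ i → Fin.zero ∈ lookup γ′ r ⊎ column k i t (toℕ r) ≡ Fin.zero) →
           Z i (suc n) k (attach γ′ (column k i t ∘ toℕ))
attach-Z {n} {k} i t γ′ 1≤n ch late-zeroFree early-zero = chain , has , lacks
  where
  col = column k i t ∘ toℕ
  chain : IsChain (suc n) k (attach γ′ col)
  chain = attach-chain γ′ col 1≤n ch
    (λ r 0∈ col≡1 → late-zeroFree r (column-one⁻ k i t (toℕ r) col≡1) 0∈)
    (λ _ _ → column-mono k i t)
  has : ∀ r → toℕ r < k ∸ i → Fin.zero ∈ lookup (attach γ′ col) r
  has r r< = subst (Fin.zero ∈_) (sym (lookup-attach γ′ col r)) ([ in-prefix , in-column ]′ (early-zero r r<))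
    where
    in-prefix = ∈-∷ʳ⁺ˡ (lookup γ′ r) (col r)
    in-column : col r ≡ Fin.zero → Fin.zero ∈ lookup γ′ r ∷ʳ col r
    in-column col≡0 = subst (_∈ lookup γ′ r ∷ʳ col r) col≡0 (∈-∷ʳ⁺ʳ (lookup γ′ r) (col r))
  lacks : ∀ r → k ∸ i ≤ toℕ r → ZeroFree (lookup (attach γ′ col) r)
  lacks r r≥ 0∈ with ∈-∷ʳ⁻ (lookup γ′ r) (col r) (subst (Fin.zero ∈_) (lookup-attach γ′ col r) 0∈)
  ... | inj₁ 0∈′ = late-zeroFree r r≥ 0∈′
  ... | inj₂ 0≡col = <⇒≱ (column-zero⁻ k i t (toℕ r) (sym 0≡col)) r≥

-- φ recovers t from the column (its 2s are the last t positions) and γ′ from the prefixes.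
φ-attach : ∀ {n k} i t (γ′ : Vec (Word n) k) → t ≤ k → φ (attach γ′ (column k i t ∘ toℕ)) ≡ (t , γ′)
φ-attach {n} {k} i t γ′ t≤k = cong₂ _,_ (final-count endsInTwo? (attach γ′ col) t≤k twos) (init-attach γ′ col)
  where
  col = column k i t ∘ toℕ
  twos : FinalSegment (EndsInTwo ∘ lookup (attach γ′ col)) t
  twos r = subst (λ a → a ≡ two ⇔ k ∸ t ≤ toℕ r) (sym (last-attach γ′ col r)) (column-two k i t (toℕ r))

-- Both parts of the target are reached: in the first, γ′ ∈ Z_i(n,k) supplies the 0s;
-- in the second (t ≤ i, γ′ ∈ Z_j(n,k) with j > i) the column supplies them.
φ-surjective : ∀ {i n k} → 1 ≤ n → i ≤ k → (p : ℕ × Vec (Word n) k) → Target n k i p →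
               Σ[ γ ∈ Vec (Word (suc n)) k ] (Z i (suc n) k γ × φ γ ≡ p)
φ-surjective {i} {n} {k} 1≤n i≤k (t , γ′) (inj₁ (t≤k , ch , has , lacks)) =
  attach γ′ (column k i t ∘ toℕ) ,
  attach-Z i t γ′ 1≤n ch lacks (λ r → inj₁ ∘ has r) ,
  φ-attach i t γ′ t≤k
φ-surjective {i} {n} {k} 1≤n i≤k (t , γ′) (inj₂ (t≤i , j , i<j , j≤k , ch , _ , lacks)) =
  attach γ′ (column k i t ∘ toℕ) ,
  attach-Z i t γ′ 1≤n ch (λ r → lacks r ∘ ≤-trans (∸-monoʳ-≤ k (<⇒≤ i<j))) (λ r → inj₂ ∘ column-zero t≤i) ,
  φ-attach i t γ′ (≤-trans t≤i i≤k)

-- The three parts are φ-sound, φ-injective and φ-surjective.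
lemma3p5 : (n k i : ℕ) → 1 ≤ n → 1 ≤ k → i ≤ k →
    ((γ : Vec (Word (suc n)) k) → Z i (suc n) k γ → Target n k i (φ γ))
    × ((γ δ : Vec (Word (suc n)) k) → Z i (suc n) k γ → Z i (suc n) k δ → φ γ ≡ φ δ → γ ≡ δ)
    × ((p : ℕ × Vec (Word n) k) → Target n k i p → Σ[ γ ∈ Vec (Word (suc n)) k ] (Z i (suc n) k γ × φ γ ≡ p))
lemma3p5 n k i 1≤n _ i≤k =
  (λ γ → φ-sound γ i≤k) , φ-injective {i} , φ-surjective 1≤n i≤k
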